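{- In the setting of the context, if $W\in\mathcal{L}$ and $E\subseteq\delta^{in}_{D^+}(W)$, then $r_W(E)\le f_W(Z)+\varrho_E(Z)$ for every nonempty $Z\subseteq W$.
   Context: $k$ is a positive integer, $D=(V,A)$ a digraph, $\mathcal{L}\subseteq 2^V$ a laminar family containing $V$ and all singletons, and $D$ contains an $\mathcal{L}$-tight $k$-arborescence. (A $k$-arborescence is the arc-disjoint union of $k$ spanning arborescences, i.e. spanning trees in the undirected sense with all in-degrees at most one; it is $r$-rooted if all are rooted at $r$; for a family $\mathcal{K}$ of node sets, a $k$-arborescence $F$ of a digraph $H$ is $\mathcal{K}$-tight if for every $U\in\mathcal{K}$ the arcs of $F$ inside $U$ form a $k$-arborescence of $H[U]$.) $D^+$ is obtained from $D$ by adding a node $s$ and $|A|+k$ parallel arcs from $s$ to each $v\in V$. For $W\in\mathcal{L}$, $\mathcal{L}[W]=\{W'\in\mathcal{L}:W'\subseteq W\}$, $D_W$ is obtained from $D^+$ by contracting $V+s-W$ into a node $s_W$ and deleting loops (arcs leaving $s_W$ identified with $\delta^{in}_{D^+}(W)$), and $r_W$ is the rank function of the matroid on $\delta^{in}_{D^+}(W)$ whose bases are the $k$-element sets extendable to an $\mathcal{L}[W]$-tight $s_W$-rooted $k$-arborescence in $D_W$. $\varrho_E(Z)$ is the number of arcs of $E$ entering $Z$. $f_W(Z)$ is the number of arcs $e$ of $D[W]$ entering $Z$ such that there is no $W'\in\mathcal{L}[W]$ with $W'\cap Z\ne\emptyset$ and $e$ leaving $W'$ (tail in $W'$, head outside $W'$).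 -}

module Defs where

open import Data.Nat using (ℕ; zero; suc; _+_; _*_; _≤_; _<_)
open import Data.Bool using (Bool; true; false; _∧_; not; if_then_else_)
open import Data.Fin using (Fin; zero; suc; splitAt; remQuot)
open import Data.Fin.Properties using (_≟_)
open import Data.Fin.Subset using (Subset; _∈_; _∉_; _⊆_; _∩_; ∣_∣; ⊤; ⁅_⁆; Nonempty)
open import Data.Vec using (Vec; lookup; tabulate; toList; _∷_)
open import Data.List using (List)
open import Data.Bool.ListAction using (or; any)
import Data.List.Membership.Propositional as LM
open import Data.Product using (Σ; _×_; ∃; _,_; proj₁; proj₂)
open import Data.Sum using (_⊎_; inj₁; inj₂)
open import Relation.Nullary.Decidable using (⌊_⌋)
open import Relation.Binary.PropositionalEquality using (_≡_)

record Digraph : Set where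
  field
    nV   : ℕ
    nA   : ℕ
    tail : Fin nA → Fin nV
    head : Fin nA → Fin nV
open Digraph public

_∈L_ : ∀ {n} → Subset n → List (Subset n) → Set
X ∈L L = X LM.∈ L

inside : (H : Digraph) → Subset (nV H) → Subset (nA H)
inside H U = tabulate (λ a → lookup U (tail H a) ∧ lookup U (head H a))

entering : (H : Digraph) → Subset (nV H) → Subset (nA H)
entering H Z = tabulate (λ a → not (lookup Z (tail H a)) ∧ lookup Z (head H a))

into : (H : Digraph) → Fin (nV H) → Subset (nA H)
into H v = tabulate (λ a → ⌊ head H a ≟ v ⌋)

indeg : (H : Digraph) → Subset (nA H) → Fin (nV H) → ℕ
indeg H T v = ∣ T ∩ into H v ∣

data Path (H : Digraph) (T : Subset (nA H)) : Fin (nV H) → Fin (nV H) → Set where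
  here : ∀ {u} → Path H T u u
  fwd  : ∀ {v} (a : Fin (nA H)) → a ∈ T → Path H T (head H a) v → Path H T (tail H a) v
  bwd  : ∀ {v} (a : Fin (nA H)) → a ∈ T → Path H T (tail H a) v → Path H T (head H a) v

-- T is a spanning arborescence of H[U]: a spanning tree of H[U] in the
-- undirected sense (connected, |U| - 1 arcs) with all in-degrees at most one.
SpanArb : (H : Digraph) → Subset (nV H) → Subset (nA H) → Set
SpanArb H U T =
  (T ⊆ inside H U)
  × (∀ u v → u ∈ U → v ∈ U → Path H T u v)
  × (∣ T ∣ + 1 ≡ ∣ U ∣)
  × (∀ v → indeg H T v ≤ 1)

colour : ∀ {m k} → (Fin m → Fin k) → Fin k → Subset m
colour col i = tabulate (λ a → ⌊ col a ≟ i ⌋)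

-- T is a k-arborescence of H[U]: arc-disjoint union of k spanning
-- arborescences of H[U] (given by a colouring of the arcs).
KArb : ℕ → (H : Digraph) → Subset (nV H) → Subset (nA H) → Set
KArb k H U T = Σ (Fin (nA H) → Fin k) λ col →
  ∀ i → SpanArb H U (T ∩ colour col i)

RootedKArb : ℕ → (H : Digraph) → Subset (nV H) → Fin (nV H) → Subset (nA H) → Set
RootedKArb k H U r T = Σ (Fin (nA H) → Fin k) λ col →
  ∀ i → SpanArb H U (T ∩ colour col i) × (indeg H (T ∩ colour col i) r ≡ 0)

Tight : ℕ → (H : Digraph) → (Subset (nV H) → Set) → Subset (nA H) → Set
Tight k H K F = ∀ U → K U → KArb k H U (F ∩ inside H U)

Laminar : ∀ {n} → List (Subset n) → Set
Laminar {n} L = ∀ X Y → X ∈L L → Y ∈L L →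
  (X ⊆ Y) ⊎ (Y ⊆ X) ⊎ (∀ (v : Fin n) → v ∈ X → v ∉ Y)

-- D⁺ : add node s (= zero; original node v becomes suc v) and
-- |A| + k parallel arcs from s to each v.  Arcs: Fin (|A| + |V| * (|A|+k));
-- the first |A| are the arcs of D, the block (v , j) is the j-th new arc s→v.

plus : ℕ → Digraph → Digraph
plus k D = record
  { nV = suc (nV D)
  ; nA = nA D + nV D * (nA D + k)
  ; tail = λ a → t (splitAt (nA D) a)
  ; head = λ a → h (splitAt (nA D) a)
  }
  where
  t : Fin (nA D) ⊎ Fin (nV D * (nA D + k)) → Fin (suc (nV D))
  t (inj₁ e) = suc (tail D e)
  t (inj₂ j) = zero
  h : Fin (nA D) ⊎ Fin (nV D * (nA D + k)) → Fin (suc (nV D))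
  h (inj₁ e) = suc (head D e)
  h (inj₂ j) = suc (proj₁ (remQuot {nV D} (nA D + k) j))

lift : ∀ {n} → Subset n → Subset (suc n)
lift Z = false ∷ Z

δinPlus : (k : ℕ) (D : Digraph) → Subset (nV D) → Subset (nA (plus k D))
δinPlus k D W = entering (plus k D) (lift W)

-- contraction map for D_W: every node of V + s - W goes to s_W (= zero)
contr : ∀ {n} → Subset n → Fin (suc n) → Fin (suc n)
contr W zero    = zero
contr W (suc v) = if lookup W v then suc v else zero

-- Its node set is {s_W} ∪ W (given by
-- nodesW); arcs keep the indices of D⁺ (loops are never used by any
-- k-arborescence, so they can be kept harmlessly; the arcs leaving s_W
-- are exactly δ^in_{D⁺}(W)).
DW : (k : ℕ) (D : Digraph) → Subset (nV D) → Digraph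
DW k D W = record
  { nV = suc (nV D)
  ; nA = nA (plus k D)
  ; tail = λ a → contr W (tail (plus k D) a)
  ; head = λ a → contr W (head (plus k D) a)
  }

nodesW : ∀ {n} → Subset n → Subset (suc n)
nodesW W = true ∷ W

LW : ∀ {n} → List (Subset n) → Subset n → Subset (suc n) → Set
LW {n} L W U = Σ (Subset n) λ W' → W' ∈L L × W' ⊆ W × U ≡ lift W'

BaseW : (k : ℕ) (D : Digraph) → List (Subset (nV D)) → Subset (nV D)
      → Subset (nA (plus k D)) → Set
BaseW k D L W B =
  B ⊆ δinPlus k D W × ∣ B ∣ ≡ k ×
  Σ (Subset (nA (plus k D))) λ F →
    B ⊆ F
    × RootedKArb k (DW k D W) (nodesW W) zero F
    × Tight k (DW k D W) (LW L W) F

IndepW : (k : ℕ) (D : Digraph) → List (Subset (nV D)) → Subset (nV D)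
       → Subset (nA (plus k D)) → Set
IndepW k D L W I = Σ (Subset (nA (plus k D))) λ B → BaseW k D L W B × I ⊆ B

-- r_W(E) ≤ c   (r_W(E) = max size of an independent subset of E)
RankW≤ : (k : ℕ) (D : Digraph) → List (Subset (nV D)) → Subset (nV D)
       → Subset (nA (plus k D)) → ℕ → Set
RankW≤ k D L W E c = ∀ I → I ⊆ E → IndepW k D L W I → ∣ I ∣ ≤ c

-- f_W(Z): arcs e of D[W] entering Z such that no W' ∈ L[W] with
-- W' ∩ Z ≠ ∅ has e leaving W'.

subsetᵇ : ∀ {n} → Subset n → Subset n → Bool
subsetᵇ X Y = not (or (toList (tabulate (λ v → lookup X v ∧ not (lookup Y v)))))

meetsᵇ : ∀ {n} → Subset n → Subset n → Bool
meetsᵇ X Y = or (toList (X ∩ Y))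

leavesᵇ : (D : Digraph) → Subset (nV D) → Fin (nA D) → Bool
leavesᵇ D X e = lookup X (tail D e) ∧ not (lookup X (head D e))

fW : (D : Digraph) → List (Subset (nV D)) → Subset (nV D) → Subset (nV D) → ℕ
fW D L W Z = ∣ tabulate (λ e →
    lookup (inside D W) e ∧ lookup (entering D Z) e
    ∧ not (any (λ W' → subsetᵇ W' W ∧ meetsᵇ W' Z ∧ leavesᵇ D W' e) L)) ∣

ϱ : (k : ℕ) (D : Digraph) → Subset (nA (plus k D)) → Subset (nV D) → ℕ
ϱ k D E Z = ∣ E ∩ entering (plus k D) (lift Z) ∣

HasTightKArb : ℕ → (D : Digraph) → List (Subset (nV D)) → Set
HasTightKArb k D L = Σ (Subset (nA D)) λ F →
  KArb k D ⊤ F × Tight k D (λ U → U ∈L L) F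

module Submission where

-- Let I ⊆ E be independent: I ⊆ B for a base B, which extends to an
-- L[W]-tight s_W-rooted k-arborescence F of D_W.  The arcs of I entering Z
-- number at most ϱ_E(Z); the others are arcs of B not entering Z, so it
-- suffices to show k ≤ ϱ_B(Z) + f_W(Z).  We exhibit, in each of the k colour
-- classes of F, an arc entering Z that lies in B or is counted by f_W(Z).
-- It is found by a descent through L[W]: tightness forces each colour to
-- enter each member of L[W] exactly once, and starting from the arc of the
-- colour entering W (an arc of B), we follow the arc entering the "core" of
-- the current member P — P ∩ Z together with the members of L[P] that split
-- P ∩ Z — recursing into a smaller member whenever that arc misses Z.

open import Defs
open import Data.Nat using (ℕ; zero; suc; _+_; _*_; _≤_; _<_; _∸_; z≤n; s≤s; s≤s⁻¹)
open import Data.Nat.Properties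
  using (≤-refl; ≤-trans; ≤-reflexive; +-mono-≤; +-mono-<-≤; +-mono-≤-<; +-monoˡ-≤; +-monoʳ-≤;
         m≤m+n; m≤n+m; +-comm; +-assoc; +-identityʳ; *-identityʳ; m∸n+n≡m; +-cancelʳ-≤; +-cancelˡ-≤;
         +-cancelʳ-≡; n≤0⇒n≡0; 1+n≰n; +-0-commutativeMonoid; module ≤-Reasoning)
import Data.Nat.Properties as ℕ
open import Data.Bool using (Bool; true; false; _∧_; _∨_; not; if_then_else_)
import Data.Bool as Bool
open import Data.Bool.Properties using (¬-not; T-≡; ∧-conicalˡ; ∧-conicalʳ; ∨-zeroʳ; ∨-identityʳ; ∧-identityʳ; ∧-zeroʳ; ∧-comm; ∧-assoc)
open import Data.Vec using (Vec; lookup; tabulate; toList; _∷_; [])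
open import Data.Vec.Properties using (lookup∘tabulate; lookup-zipWith; []=⇒lookup; lookup⇒[]=)
open import Data.Fin.Subset using (Subset; _⊆_; _∩_; ∣_∣; ⊤; ⁅_⁆; Nonempty)
import Data.Fin.Subset as Subset
open import Data.Fin.Subset.Properties using (⊆-refl)
open import Data.List using (List)
open import Data.Bool.ListAction using (or; any)
open import Data.List.Relation.Unary.Any.Properties using (any⁺; any⁻)
open import Data.List.Membership.Propositional using (find; lose)
import Data.List.Membership.Propositional as List
open import Function.Bundles using (Equivalence)
open import Data.Fin using (Fin; zero; suc; splitAt)
open import Data.Fin.Properties using (_≟_; any?; suc-injective)
open import Data.Product using (_×_; ∃; _,_; proj₁; proj₂)
open import Data.Sum using (_⊎_; inj₁; inj₂)
import Data.Sum as Sum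
open import Data.Empty using (⊥-elim)
open import Relation.Nullary using (¬_; yes; no)
open import Relation.Nullary.Decidable using (⌊_⌋; Dec; dec-true; dec-false; isYes≗does)
open import Relation.Binary.PropositionalEquality
  using (_≡_; _≢_; refl; sym; trans; cong; cong₂; subst; subst₂; module ≡-Reasoning)
open import Algebra.Properties.CommutativeMonoid.Sum +-0-commutativeMonoid
  using (sum; sum-syntax; sum-cong-≗; ∑-distrib-+; ∑-comm; sum-replicate-zero)

∧-intro : ∀ {x y} → x ≡ true → y ≡ true → (x ∧ y) ≡ true
∧-intro refl refl = refl

∧-elim : ∀ {x y} → (x ∧ y) ≡ true → x ≡ true × y ≡ true
∧-elim {x} {y} h = ∧-conicalˡ x y h , ∧-conicalʳ x y h

⌊⌋-true : ∀ {A : Set} (d : Dec A) → A → ⌊ d ⌋ ≡ true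
⌊⌋-true d a = trans (isYes≗does d) (dec-true d a)

⌊⌋-false : ∀ {A : Set} (d : Dec A) → ¬ A → ⌊ d ⌋ ≡ false
⌊⌋-false d ¬a = trans (isYes≗does d) (dec-false d ¬a)

⌊⌋-sound : ∀ {A : Set} (d : Dec A) → ⌊ d ⌋ ≡ true → A
⌊⌋-sound (yes a) _ = a

false≢true : false ≢ true
false≢true ()

not-true : ∀ {b} → not b ≡ true → b ≡ false
not-true {false} _ = refl

not-false : ∀ {b} → not b ≡ false → b ≡ true
not-false {true} _ = refl

∧-forget : ∀ x y z → ((x ∧ y) ∧ z) ≡ true → (x ∧ z) ≡ true
∧-forget true true z h = h

χ : Bool → ℕ
χ true  = 1
χ false = 0

χ-mono : ∀ {a b} → (a ≡ true → b ≡ true) → χ a ≤ χ b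
χ-mono {false} _ = z≤n
χ-mono {true}  h rewrite h refl = ≤-refl

count : ∀ {n} → (Fin n → Bool) → ℕ
count {n} p = ∑[ i < n ] χ (p i)

∑-mono-≤ : ∀ {n} {f g : Fin n → ℕ} → (∀ i → f i ≤ g i) → sum f ≤ sum g
∑-mono-≤ {zero}  h = z≤n
∑-mono-≤ {suc n} h = +-mono-≤ (h zero) (∑-mono-≤ (λ i → h (suc i)))

∑-mono-< : ∀ {n} {f g : Fin n → ℕ} → (∀ i → f i ≤ g i) → ∀ j → f j < g j → sum f < sum g
∑-mono-< {suc n} h zero    lt = +-mono-<-≤ lt (∑-mono-≤ (λ i → h (suc i)))
∑-mono-< {suc n} h (suc j) lt = +-mono-≤-< (h zero) (∑-mono-< (λ i → h (suc i)) j lt)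

∑-const : ∀ n c → ∑[ i < n ] c ≡ n * c
∑-const zero    c = refl
∑-const (suc n) c = cong (c +_) (∑-const n c)

term≤∑ : ∀ {n} (f : Fin n → ℕ) i → f i ≤ sum f
term≤∑ f zero    = m≤m+n _ _
term≤∑ f (suc i) = ≤-trans (term≤∑ (λ j → f (suc j)) i) (m≤n+m _ (f zero))

count-< : ∀ {n} {p q : Fin n → Bool} → (∀ i → p i ≡ true → q i ≡ true) →
  ∀ j → q j ≡ true → p j ≡ false → count p < count q
count-< p⇒q j qj pj = ∑-mono-< (λ i → χ-mono (p⇒q i)) j (subst₂ (λ x y → χ x < χ y) (sym pj) (sym qj) ≤-refl)

count-∨ : ∀ {n} (p q : Fin n → Bool) → count (λ i → p i ∨ q i) ≤ count p + count q
count-∨ p q = ≤-trans (∑-mono-≤ (λ i → χ-∨ (p i) (q i))) (≤-reflexive (∑-distrib-+ (λ i → χ (p i)) (λ i → χ (q i))))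
  where
  χ-∨ : ∀ x y → χ (x ∨ y) ≤ χ x + χ y
  χ-∨ true  y = s≤s z≤n
  χ-∨ false y = ≤-refl

∑-splitAt : ∀ m {n} (h : Fin m ⊎ Fin n → ℕ) →
  ∑[ a < m + n ] h (splitAt m a) ≡ ∑[ d < m ] h (inj₁ d) + ∑[ j < n ] h (inj₂ j)
∑-splitAt zero    h = refl
∑-splitAt (suc m) h = trans (cong (h (inj₁ zero) +_) (∑-splitAt m (λ s → h (Sum.map₁ suc s))))
                            (sym (+-assoc (h (inj₁ zero)) _ _))

each≤1 : ∀ {k} (g : Fin k → ℕ) → sum g ≤ k → (∀ j → 1 ≤ g j) → ∀ i → g i ≤ 1
each≤1 {k} g le ge i = subst (_≤ 1) (m∸n+n≡m (ge i)) (+-monoˡ-≤ 1 excess-i)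
  where
  total : ∑[ j < k ] (g j ∸ 1) + k ≡ sum g
  total = begin
    ∑[ j < k ] (g j ∸ 1) + k               ≡⟨ cong (∑[ j < k ] (g j ∸ 1) +_) (sym (trans (∑-const k 1) (*-identityʳ k))) ⟩
    ∑[ j < k ] (g j ∸ 1) + ∑[ j < k ] 1    ≡⟨ sym (∑-distrib-+ (λ j → g j ∸ 1) (λ _ → 1)) ⟩
    ∑[ j < k ] (g j ∸ 1 + 1)               ≡⟨ sum-cong-≗ (λ j → m∸n+n≡m (ge j)) ⟩
    sum g                                  ∎
    where open ≡-Reasoning
  excess-i : g i ∸ 1 ≤ 0
  excess-i = ≤-trans (term≤∑ (λ j → g j ∸ 1) i)
               (+-cancelʳ-≤ k (∑[ j < k ] (g j ∸ 1)) 0 (subst (_≤ k) (sym total) le))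

count-≟ : ∀ {n} (j : Fin n) → count (λ i → ⌊ j ≟ i ⌋) ≡ 1
count-≟ {suc n} zero = cong (1 +_) (sum-replicate-zero n)
count-≟ {suc n} (suc j) = trans (cong (χ ⌊ suc j ≟ zero ⌋ +_) (sum-cong-≗ shift)) (count-≟ j)
  where
  shift : ∀ i → χ ⌊ suc j ≟ suc i ⌋ ≡ χ ⌊ j ≟ i ⌋
  shift i with j ≟ i | suc j ≟ suc i
  ... | yes _   | yes _ = refl
  ... | no  _   | no  _ = refl
  ... | yes j≡i | no  sj≢si = ⊥-elim (sj≢si (cong suc j≡i))
  ... | no  j≢i | yes sj≡si = ⊥-elim (j≢i (suc-injective sj≡si))

count-point : ∀ {n} b (j : Fin n) → count (λ v → b ∧ ⌊ j ≟ v ⌋) ≡ χ b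
count-point {n} true  j = count-≟ j
count-point {n} false j = sum-replicate-zero n

count-by-colour : ∀ {m k} (col : Fin m → Fin k) (p : Fin m → Bool) →
  ∑[ i < k ] count (λ a → p a ∧ ⌊ col a ≟ i ⌋) ≡ count p
count-by-colour {m} {k} col p =
  trans (∑-comm (λ i a → χ (p a ∧ ⌊ col a ≟ i ⌋))) (sum-cong-≗ colours-of)
  where
  colours-of : ∀ a → ∑[ i < k ] χ (p a ∧ ⌊ col a ≟ i ⌋) ≡ χ (p a)
  colours-of a = count-point (p a) (col a)

colours-hit : ∀ {m k} (col : Fin m → Fin k) (S : Fin m → Bool) →
  (∀ j → ∃ λ a → col a ≡ j × S a ≡ true) → k ≤ count S
colours-hit {m} {k} col S hit = begin
  k                                          ≡⟨ sym (trans (∑-const k 1) (*-identityʳ k)) ⟩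
  ∑[ j < k ] 1                               ≤⟨ ∑-mono-≤ class-hit ⟩
  ∑[ j < k ] count (λ a → S a ∧ ⌊ col a ≟ j ⌋) ≡⟨ count-by-colour col S ⟩
  count S                                    ∎
  where
  open ≤-Reasoning
  class-hit : ∀ j → 1 ≤ count (λ a → S a ∧ ⌊ col a ≟ j ⌋)
  class-hit j = let a , col≡j , Sa = hit j in
    ≤-trans (≤-reflexive (cong χ (sym (∧-intro Sa (⌊⌋-true (col a ≟ j) col≡j)))))
            (term≤∑ (λ a → χ (S a ∧ ⌊ col a ≟ j ⌋)) a)

count-false : ∀ {n} (p : Fin n → Bool) → (∀ i → p i ≡ false) → count p ≡ 0
count-false {n} p none = trans (sum-cong-≗ (λ i → cong χ (none i))) (sum-replicate-zero n)

count≤1-unique : ∀ {n} (p : Fin n → Bool) → count p ≤ 1 →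
  ∀ a b → p a ≡ true → p b ≡ true → a ≡ b
count≤1-unique {n} p le a b pa pb with a ≟ b
... | yes a≡b = a≡b
... | no  a≢b = ⊥-elim (1+n≰n (≤-trans (≤-reflexive (sym two)) (≤-trans (∑-mono-≤ both) le)))
  where
  two : ∑[ v < n ] (χ ⌊ a ≟ v ⌋ + χ ⌊ b ≟ v ⌋) ≡ 2
  two = trans (∑-distrib-+ (λ v → χ ⌊ a ≟ v ⌋) (λ v → χ ⌊ b ≟ v ⌋)) (cong₂ _+_ (count-≟ a) (count-≟ b))
  both : ∀ v → χ ⌊ a ≟ v ⌋ + χ ⌊ b ≟ v ⌋ ≤ χ (p v)
  both v with a ≟ v | b ≟ v
  ... | yes refl | yes refl = ⊥-elim (a≢b refl)
  ... | yes refl | no  _    rewrite pa = ≤-refl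
  ... | no  _    | yes refl rewrite pb = ≤-refl
  ... | no  _    | no  _    = z≤n

count-at : ∀ {n} (p : Fin n → Bool) (j : Fin n) → count (λ v → p v ∧ ⌊ j ≟ v ⌋) ≡ χ (p j)
count-at {n} p j = trans (sum-cong-≗ at-j) (count-point (p j) j)
  where
  at-j : ∀ v → χ (p v ∧ ⌊ j ≟ v ⌋) ≡ χ (p j ∧ ⌊ j ≟ v ⌋)
  at-j v with j ≟ v
  ... | yes refl = refl
  ... | no  _    rewrite ∧-zeroʳ (p v) | ∧-zeroʳ (p j) = refl

count-split : ∀ {n} (p q : Fin n → Bool) →
  count p ≡ count (λ i → p i ∧ q i) + count (λ i → p i ∧ not (q i))
count-split p q = trans (sum-cong-≗ split) (∑-distrib-+ (λ i → χ (p i ∧ q i)) (λ i → χ (p i ∧ not (q i))))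
  where
  split : ∀ i → χ (p i) ≡ χ (p i ∧ q i) + χ (p i ∧ not (q i))
  split i with p i | q i
  ... | true  | true  = refl
  ... | true  | false = refl
  ... | false | _     = refl

count-mono : ∀ {n} {p q : Fin n → Bool} → (∀ i → p i ≡ true → q i ≡ true) → count p ≤ count q
count-mono p⇒q = ∑-mono-≤ (λ i → χ-mono (p⇒q i))

find-true : ∀ {n} (p : Fin n → Bool) → (∃ λ i → p i ≡ true) ⊎ (∀ i → p i ≡ false)
find-true p with any? (λ i → p i Bool.≟ true)
... | yes found = inj₁ found
... | no  none  = inj₂ (λ i → ¬-not (λ pi → none (i , pi)))

∣∣≡count : ∀ {n} (S : Subset n) → ∣ S ∣ ≡ count (lookup S)
∣∣≡count []          = refl
∣∣≡count (true ∷ S)  = cong suc (∣∣≡count S)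
∣∣≡count (false ∷ S) = ∣∣≡count S

lookup-∩ : ∀ {n} (S T : Subset n) v → lookup (S ∩ T) v ≡ (lookup S v ∧ lookup T v)
lookup-∩ S T v = lookup-zipWith _∧_ v S T

∈⇒lookup : ∀ {n} {S : Subset n} {v} → v Subset.∈ S → lookup S v ≡ true
∈⇒lookup = []=⇒lookup

lookup⇒∈ : ∀ {n} {S : Subset n} {v} → lookup S v ≡ true → v Subset.∈ S
lookup⇒∈ {S = S} {v} = lookup⇒[]= v S

_⊑_ : ∀ {n} → Subset n → Subset n → Set
X ⊑ Y = ∀ v → lookup X v ≡ true → lookup Y v ≡ true

⊑-refl : ∀ {n} (X : Subset n) → X ⊑ X
⊑-refl X _ h = h

⊆⇒⊑ : ∀ {n} {X Y : Subset n} → X ⊆ Y → X ⊑ Y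
⊆⇒⊑ X⊆Y v Xv = ∈⇒lookup (X⊆Y (lookup⇒∈ Xv))

⊑⇒⊆ : ∀ {n} {X Y : Subset n} → X ⊑ Y → X ⊆ Y
⊑⇒⊆ X⊑Y v∈X = lookup⇒∈ (X⊑Y _ (∈⇒lookup v∈X))

Meets : ∀ {n} → Subset n → Subset n → Set
Meets X Y = ∃ λ v → lookup X v ≡ true × lookup Y v ≡ true

or-true⇒ : ∀ {n} (v : Vec Bool n) → or (toList v) ≡ true → ∃ λ i → lookup v i ≡ true
or-true⇒ (true ∷ v)  h = zero , refl
or-true⇒ (false ∷ v) h with or-true⇒ v h
... | i , vi = suc i , vi

⇒or-true : ∀ {n} (v : Vec Bool n) i → lookup v i ≡ true → or (toList v) ≡ true
⇒or-true (true ∷ v)  i       h = refl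
⇒or-true (false ∷ v) zero    ()
⇒or-true (false ∷ v) (suc i) h = ⇒or-true v i h

subsetᵇ-complete : ∀ {n} (X Y : Subset n) → X ⊑ Y → subsetᵇ X Y ≡ true
subsetᵇ-complete X Y X⊑Y = cong not (¬-not λ found →
  let v , v∈diff = or-true⇒ (tabulate (λ u → lookup X u ∧ not (lookup Y u))) found
      Xv , ¬Yv = ∧-elim {lookup X v} (trans (sym (lookup∘tabulate (λ u → lookup X u ∧ not (lookup Y u)) v)) v∈diff)
  in false≢true (trans (sym (not-true ¬Yv)) (X⊑Y v Xv)))

subsetᵇ-refute : ∀ {n} (X Y : Subset n) v → lookup X v ≡ true → lookup Y v ≡ false → subsetᵇ X Y ≡ false
subsetᵇ-refute X Y v Xv Yv = cong not (⇒or-true (tabulate (λ u → lookup X u ∧ not (lookup Y u))) v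
  (trans (lookup∘tabulate (λ u → lookup X u ∧ not (lookup Y u)) v) (∧-intro Xv (cong not Yv))))

subsetᵇ-sound : ∀ {n} (X Y : Subset n) → subsetᵇ X Y ≡ true → X ⊑ Y
subsetᵇ-sound X Y h v Xv with lookup Y v in Yv
... | true  = refl
... | false with () ← trans (sym h) (subsetᵇ-refute X Y v Xv Yv)

subsetᵇ-false : ∀ {n} (X Y : Subset n) → subsetᵇ X Y ≡ false →
  ∃ λ v → lookup X v ≡ true × lookup Y v ≡ false
subsetᵇ-false X Y h with or-true⇒ (tabulate (λ u → lookup X u ∧ not (lookup Y u))) (not-false h)
... | v , Xv¬Yv with ∧-elim (trans (sym (lookup∘tabulate (λ u → lookup X u ∧ not (lookup Y u)) v)) Xv¬Yv)
...   | Xv , ¬Yv = v , Xv , not-true ¬Yv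

meetsᵇ-sound : ∀ {n} (X Y : Subset n) → meetsᵇ X Y ≡ true → Meets X Y
meetsᵇ-sound X Y h with or-true⇒ (X ∩ Y) h
... | v , XYv = v , ∧-elim (trans (sym (lookup-∩ X Y v)) XYv)

meetsᵇ-complete : ∀ {n} (X Y : Subset n) → Meets X Y → meetsᵇ X Y ≡ true
meetsᵇ-complete X Y (v , Xv , Yv) = ⇒or-true (X ∩ Y) v (trans (lookup-∩ X Y v) (∧-intro Xv Yv))

any-sound : ∀ {A : Set} (p : A → Bool) (l : List A) → any p l ≡ true →
  ∃ λ x → x List.∈ l × p x ≡ true
any-sound p l h with find (any⁻ p l (Equivalence.from T-≡ h))
... | x , x∈l , px = x , x∈l , Equivalence.to T-≡ px

any-complete : ∀ {A : Set} (p : A → Bool) (l : List A) x → x List.∈ l → p x ≡ true → any p l ≡ true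
any-complete p l x x∈l px = Equivalence.to T-≡ (any⁺ p (lose x∈l (Equivalence.from T-≡ px)))

any-false : ∀ {A : Set} (p : A → Bool) (l : List A) → (∀ x → x List.∈ l → p x ≡ false) → any p l ≡ false
any-false p l none = ¬-not λ found → let x , x∈l , px = any-sound p l found in
  false≢true (trans (sym (none x x∈l)) px)

relabel : (H : Digraph) → (Fin (nV H) → Fin (nV H)) → Digraph
relabel H f = record { nV = nV H ; nA = nA H ; tail = λ a → f (tail H a) ; head = λ a → f (head H a) }

ArcsWithin : (H : Digraph) → Subset (nV H) → Subset (nA H) → Set
ArcsWithin H U T = ∀ a → lookup T a ≡ true → lookup U (tail H a) ≡ true × lookup U (head H a) ≡ true

Connects : (H : Digraph) → Subset (nV H) → Subset (nA H) → Set
Connects H U T = ∀ u v → lookup U u ≡ true → lookup U v ≡ true → Path H T u v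

-- Renaming nodes along f maps walks to walks; arcs of T outside T' may
-- be used only if f turns them into loops, and then they are skipped.
contract-path : ∀ {H} {T T' : Subset (nA H)} (f : Fin (nV H) → Fin (nV H)) →
  (∀ a → lookup T a ≡ true → lookup T' a ≡ true ⊎ f (tail H a) ≡ f (head H a)) →
  ∀ {u v} → Path H T u v → Path (relabel H f) T' (f u) (f v)
contract-path f kept here = here
contract-path {H} {T' = T'} f kept {v = v} (fwd a a∈T p) with kept a (∈⇒lookup a∈T)
... | inj₁ a∈T' = fwd a (lookup⇒∈ a∈T') (contract-path f kept p)
... | inj₂ loop = subst (λ x → Path (relabel H f) T' x (f v)) (sym loop) (contract-path f kept p)
contract-path {H} {T' = T'} f kept {v = v} (bwd a a∈T p) with kept a (∈⇒lookup a∈T)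
... | inj₁ a∈T' = bwd a (lookup⇒∈ a∈T') (contract-path f kept p)
... | inj₂ loop = subst (λ x → Path (relabel H f) T' x (f v)) loop (contract-path f kept p)

path-no-arcs : ∀ {H T} → (∀ a → lookup T a ≡ false) → ∀ {u v} → Path H T u v → u ≡ v
path-no-arcs none here = refl
path-no-arcs none (fwd a a∈T p) with () ← trans (sym (∈⇒lookup a∈T)) (none a)
path-no-arcs none (bwd a a∈T p) with () ← trans (sym (∈⇒lookup a∈T)) (none a)

collapse : ∀ {n} → Subset n → Fin n → Fin n → Fin n
collapse X x0 x = if lookup X x then x0 else x

contracted : ∀ {n} → Subset n → Subset n → Fin n → Subset n
contracted U X x0 = tabulate (λ v → (lookup U v ∧ not (lookup X v)) ∨ ⌊ x0 ≟ v ⌋)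

module Contraction (H : Digraph) (U X : Subset (nV H)) (x0 : Fin (nV H)) where

  f : Fin (nV H) → Fin (nV H)
  f = collapse X x0

  U' : Subset (nV H)
  U' = contracted U X x0

  H' : Digraph
  H' = relabel H f

  collapse-fixes : f x0 ≡ x0
  collapse-fixes with lookup X x0
  ... | true  = refl
  ... | false = refl

  collapse-inside : ∀ x → lookup X x ≡ true → f x ≡ x0
  collapse-inside x Xx = cong (λ b → if b then x0 else x) Xx

  collapse-outside : ∀ x → lookup X x ≡ false → f x ≡ x
  collapse-outside x Xx = cong (λ b → if b then x0 else x) Xx

  lookup-contracted : ∀ v → lookup U' v ≡ ((lookup U v ∧ not (lookup X v)) ∨ ⌊ x0 ≟ v ⌋)
  lookup-contracted = lookup∘tabulate (λ v → (lookup U v ∧ not (lookup X v)) ∨ ⌊ x0 ≟ v ⌋)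

  x0∈U' : lookup U' x0 ≡ true
  x0∈U' = trans (lookup-contracted x0)
    (trans (cong ((lookup U x0 ∧ not (lookup X x0)) ∨_) (⌊⌋-true (x0 ≟ x0) refl)) (∨-zeroʳ _))

  collapse-into : ∀ x → lookup U x ≡ true → lookup U' (f x) ≡ true
  collapse-into x Ux with lookup X x in Xx
  ... | true  = x0∈U'
  ... | false = trans (lookup-contracted x) (cong₂ (λ b c → (b ∧ not c) ∨ ⌊ x0 ≟ x ⌋) Ux Xx)

  collapse-onto : lookup U x0 ≡ true → ∀ w → lookup U' w ≡ true → ∃ λ u → lookup U u ≡ true × f u ≡ w
  collapse-onto Ux0 w w∈U' with x0 ≟ w
  ... | yes refl = x0 , Ux0 , collapse-fixes
  ... | no  x0≢w = w , proj₁ Uw¬Xw , collapse-outside w (not-true (proj₂ Uw¬Xw))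
    where
    Uw¬Xw : lookup U w ≡ true × not (lookup X w) ≡ true
    Uw¬Xw = ∧-elim (begin
      lookup U w ∧ not (lookup X w)                          ≡⟨ sym (∨-identityʳ _) ⟩
      (lookup U w ∧ not (lookup X w)) ∨ false                ≡⟨ cong (_ ∨_) (sym (⌊⌋-false (x0 ≟ w) x0≢w)) ⟩
      (lookup U w ∧ not (lookup X w)) ∨ ⌊ x0 ≟ w ⌋           ≡⟨ sym (lookup-contracted w) ⟩
      lookup U' w                                            ≡⟨ w∈U' ⟩
      true                                                   ∎)
      where open ≡-Reasoning

  contract-within : ∀ {T T'} → ArcsWithin H U T → T' ⊑ T → ArcsWithin H' U' T'
  contract-within within T'⊆T a a∈T' =
    collapse-into (tail H a) (proj₁ (within a (T'⊆T a a∈T'))) , collapse-into (head H a) (proj₂ (within a (T'⊆T a a∈T')))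

  contract-connects : ∀ {T T'} → lookup U x0 ≡ true →
    (∀ a → lookup T a ≡ true → lookup T' a ≡ true ⊎ f (tail H a) ≡ f (head H a)) →
    Connects H U T → Connects H' U' T'
  contract-connects Ux0 kept conn u' v' u'∈ v'∈ with collapse-onto Ux0 u' u'∈ | collapse-onto Ux0 v' v'∈
  ... | u , Uu , refl | v , Uv , refl = contract-path f kept (conn u v Uu Uv)

  contracted-size : X ⊑ U → lookup U x0 ≡ true →
    count (lookup U') + count (lookup X) ≡ count (lookup U) + χ (lookup X x0)
  contracted-size X⊑U Ux0 = begin
    count (lookup U') + count (lookup X)
      ≡⟨ sym (∑-distrib-+ (λ v → χ (lookup U' v)) (λ v → χ (lookup X v))) ⟩
    ∑[ v < nV H ] (χ (lookup U' v) + χ (lookup X v))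
      ≡⟨ sum-cong-≗ pointwise ⟩
    ∑[ v < nV H ] (χ (lookup U v) + χ (lookup X x0 ∧ ⌊ x0 ≟ v ⌋))
      ≡⟨ ∑-distrib-+ (λ v → χ (lookup U v)) (λ v → χ (lookup X x0 ∧ ⌊ x0 ≟ v ⌋)) ⟩
    count (lookup U) + count (λ v → lookup X x0 ∧ ⌊ x0 ≟ v ⌋)
      ≡⟨ cong (count (lookup U) +_) (count-point (lookup X x0) x0) ⟩
    count (lookup U) + χ (lookup X x0) ∎
    where
    open ≡-Reasoning
    pointwise : ∀ v → χ (lookup U' v) + χ (lookup X v) ≡ χ (lookup U v) + χ (lookup X x0 ∧ ⌊ x0 ≟ v ⌋)
    pointwise v rewrite lookup-contracted v with x0 ≟ v
    ... | yes refl rewrite ∨-zeroʳ (lookup U x0 ∧ not (lookup X x0)) | Ux0 | ∧-identityʳ (lookup X x0) = refl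
    ... | no _ rewrite ∨-identityʳ (lookup U v ∧ not (lookup X v)) | ∧-zeroʳ (lookup X x0) | +-identityʳ (χ (lookup U v))
      with lookup X v in Xv
    ...   | true  rewrite X⊑U v Xv = refl
    ...   | false rewrite ∧-identityʳ (lookup U v) = +-identityʳ _

  contracted-size-within : X ⊑ U → lookup X x0 ≡ true →
    count (lookup U') ≡ count (λ v → lookup U v ∧ not (lookup X v)) + 1
  contracted-size-within X⊑U x0∈X = +-cancelʳ-≡ (count (lookup X)) _ _ (begin
    count (lookup U') + count (lookup X)                        ≡⟨ contracted-size X⊑U (X⊑U x0 x0∈X) ⟩
    count (lookup U) + χ (lookup X x0)                          ≡⟨ cong₂ _+_ (count-split (lookup U) (lookup X)) (cong χ x0∈X) ⟩
    count (λ v → lookup U v ∧ lookup X v) + count U∖X + 1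
      ≡⟨ cong (λ m → m + count U∖X + 1) (sum-cong-≗ (λ v → cong χ (U∧X≡X v))) ⟩
    count (lookup X) + count U∖X + 1                            ≡⟨ +-assoc (count (lookup X)) _ 1 ⟩
    count (lookup X) + (count U∖X + 1)                          ≡⟨ +-comm (count (lookup X)) _ ⟩
    count U∖X + 1 + count (lookup X)                            ∎)
    where
    open ≡-Reasoning
    U∖X : Fin (nV H) → Bool
    U∖X v = lookup U v ∧ not (lookup X v)
    U∧X≡X : ∀ v → (lookup U v ∧ lookup X v) ≡ lookup X v
    U∧X≡X v with lookup X v in Xv
    ... | true  = cong (_∧ true) (X⊑U v Xv)
    ... | false = ∧-zeroʳ (lookup U v)

connected-no-arcs : ∀ H U T → (∀ a → lookup T a ≡ false) → Connects H U T → count (lookup U) ≤ 1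
connected-no-arcs H U T none conn with find-true (lookup U)
... | inj₂ empty = subst (_≤ 1) (sym (count-false (lookup U) empty)) z≤n
... | inj₁ (u0 , Uu0) = subst (_ ≤_) (count-≟ u0) (∑-mono-≤ only-u0)
  where
  only-u0 : ∀ v → χ (lookup U v) ≤ χ ⌊ u0 ≟ v ⌋
  only-u0 v = χ-mono (λ Uv → ⌊⌋-true (u0 ≟ v) (path-no-arcs none (conn u0 v Uu0 Uv)))

remove : ∀ {n} → Subset n → Fin n → Subset n
remove S a = tabulate (λ b → lookup S b ∧ not ⌊ a ≟ b ⌋)

module _ {n} (S : Subset n) (a : Fin n) where

  lookup-remove : ∀ b → lookup (remove S a) b ≡ (lookup S b ∧ not ⌊ a ≟ b ⌋)
  lookup-remove = lookup∘tabulate (λ b → lookup S b ∧ not ⌊ a ≟ b ⌋)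

  remove-size : lookup S a ≡ true → count (lookup S) ≡ suc (count (lookup (remove S a)))
  remove-size Sa = begin
    count (lookup S)
      ≡⟨ sum-cong-≗ split ⟩
    ∑[ b < n ] (χ ⌊ a ≟ b ⌋ + χ (lookup (remove S a) b))
      ≡⟨ ∑-distrib-+ (λ b → χ ⌊ a ≟ b ⌋) (λ b → χ (lookup (remove S a) b)) ⟩
    count (λ b → ⌊ a ≟ b ⌋) + count (lookup (remove S a))
      ≡⟨ cong (_+ count (lookup (remove S a))) (count-≟ a) ⟩
    suc (count (lookup (remove S a))) ∎
    where
    open ≡-Reasoning
    split : ∀ b → χ (lookup S b) ≡ χ ⌊ a ≟ b ⌋ + χ (lookup (remove S a) b)
    split b rewrite lookup-remove b with a ≟ b
    ... | yes refl rewrite Sa = refl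
    ... | no  _    rewrite ∧-identityʳ (lookup S b) = refl

  remove-size′ : ∀ {m} → lookup S a ≡ true → count (lookup S) ≡ suc m → count (lookup (remove S a)) ≡ m
  remove-size′ Sa |S| = ℕ.suc-injective (trans (sym (remove-size Sa)) |S|)

  remove-⊆ : ∀ b → lookup (remove S a) b ≡ true → lookup S b ≡ true
  remove-⊆ b h = proj₁ (∧-elim (trans (sym (lookup-remove b)) h))

  remove-kept : ∀ b → lookup S b ≡ true → lookup (remove S a) b ≡ true ⊎ b ≡ a
  remove-kept b Sb with a ≟ b in a≟b
  ... | yes a≡b = inj₂ (sym a≡b)
  ... | no  a≢b = inj₁ (trans (lookup-remove b) (cong₂ (λ x y → x ∧ not y) Sb (⌊⌋-false (a ≟ b) a≢b)))

drop-loop : ∀ H U T a → lookup T a ≡ true → tail H a ≡ head H a → Connects H U T → Connects H U (remove T a)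
drop-loop H U T a Ta loop conn u v Uu Uv = contract-path (λ x → x) drop-a (conn u v Uu Uv)
  where
  drop-a : ∀ b → lookup T b ≡ true → lookup (remove T a) b ≡ true ⊎ tail H b ≡ head H b
  drop-a b Tb = Sum.map₂ (λ { refl → loop }) (remove-kept T a b Tb)

module ArcContraction (H : Digraph) (U : Subset (nV H)) (T : Subset (nA H)) (a : Fin (nA H))
  (Ta : lookup T a ≡ true) (proper : tail H a ≢ head H a) (within : ArcsWithin H U T) where

  X : Subset (nV H)
  X = tabulate (λ x → ⌊ head H a ≟ x ⌋)

  open Contraction H U X (tail H a) public using (H'; U'; f)
  private module C = Contraction H U X (tail H a)

  lookup-X : ∀ x → lookup X x ≡ ⌊ head H a ≟ x ⌋
  lookup-X = lookup∘tabulate (λ x → ⌊ head H a ≟ x ⌋)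

  X⊑U : X ⊑ U
  X⊑U x Xx with head H a ≟ x in eq
  ... | yes refl = proj₂ (within a Ta)
  ... | no  _ with () ← trans (sym Xx) (trans (lookup-X x) (cong ⌊_⌋ eq))

  shrinks : count (lookup U) ≡ suc (count (lookup U'))
  shrinks = begin
    count (lookup U)                           ≡⟨ sym (+-identityʳ _) ⟩
    count (lookup U) + 0                       ≡⟨ cong (λ b → count (lookup U) + χ b) (sym tail∉X) ⟩
    count (lookup U) + χ (lookup X (tail H a)) ≡⟨ sym (C.contracted-size X⊑U (proj₁ (within a Ta))) ⟩
    count (lookup U') + count (lookup X)       ≡⟨ cong (count (lookup U') +_) |X| ⟩
    count (lookup U') + 1                      ≡⟨ +-comm _ 1 ⟩
    suc (count (lookup U'))                    ∎
    where
    open ≡-Reasoning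
    tail∉X : lookup X (tail H a) ≡ false
    tail∉X = trans (lookup-X (tail H a)) (⌊⌋-false (head H a ≟ tail H a) (λ e → proper (sym e)))
    |X| : count (lookup X) ≡ 1
    |X| = trans (sum-cong-≗ (λ x → cong χ (lookup-X x))) (count-≟ (head H a))

  within' : ArcsWithin H' U' (remove T a)
  within' = C.contract-within {T} {remove T a} within (remove-⊆ T a)

  connects' : Connects H U T → Connects H' U' (remove T a)
  connects' = C.contract-connects {T} {remove T a} (proj₁ (within a Ta)) a-becomes-loop
    where
    a-becomes-loop : ∀ b → lookup T b ≡ true → lookup (remove T a) b ≡ true ⊎ f (tail H b) ≡ f (head H b)
    a-becomes-loop b Tb = Sum.map₂ (λ { refl → trans C.collapse-fixes
      (sym (C.collapse-inside (head H a) (trans (lookup-X (head H a)) (⌊⌋-true (head H a ≟ head H a) refl)))) })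
      (remove-kept T a b Tb)

-- A set connected by an arc set T within it has at most |T| + 1 nodes,
-- by induction on |T|: a loop can be dropped, and any other arc contracted.
connected-size : ∀ H U T → ArcsWithin H U T → Connects H U T → count (lookup U) ≤ count (lookup T) + 1
connected-size H U T = go (count (lookup T)) H U T refl
  where
  go : ∀ m H U T → count (lookup T) ≡ m → ArcsWithin H U T → Connects H U T → count (lookup U) ≤ m + 1
  go m H U T |T| within conn with find-true (lookup T)
  ... | inj₂ none = ≤-trans (connected-no-arcs H U T none conn) (m≤n+m 1 m)
  go zero H U T |T| within conn | inj₁ (a , Ta) with () ← trans (sym (remove-size T a Ta)) |T|
  go (suc m) H U T |T| within conn | inj₁ (a , Ta) with tail H a ≟ head H a
  ... | yes loop   = ≤-trans (go m H U (remove T a) (remove-size′ T a Ta |T|) (λ b b∈ → within b (remove-⊆ T a b b∈))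
                                  (drop-loop H U T a Ta loop conn))
                             (m≤n+m _ 1)
  ... | no  proper = subst (_≤ suc m + 1) (sym A.shrinks)
                       (s≤s (go m A.H' A.U' (remove T a) (remove-size′ T a Ta |T|) A.within' (A.connects' conn)))
    where module A = ArcContraction H U T a Ta proper within

indeg≡count : ∀ H T v → indeg H T v ≡ count (λ a → lookup T a ∧ ⌊ head H a ≟ v ⌋)
indeg≡count H T v = trans (∣∣≡count (T ∩ into H v)) (sum-cong-≗ λ a →
  cong χ (trans (lookup-∩ T (into H v) a) (cong (lookup T a ∧_) (lookup∘tabulate (λ a → ⌊ head H a ≟ v ⌋) a))))

Enters : (H : Digraph) → Subset (nV H) → Fin (nA H) → Set
Enters H X a = lookup X (tail H a) ≡ false × lookup X (head H a) ≡ true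

lookup-colour : ∀ {m k} (S : Subset m) (col : Fin m → Fin k) i a →
  lookup (S ∩ colour col i) a ≡ (lookup S a ∧ ⌊ col a ≟ i ⌋)
lookup-colour S col i a = trans (lookup-∩ S (colour col i) a) (cong (lookup S a ∧_) (lookup∘tabulate (λ a → ⌊ col a ≟ i ⌋) a))

lookup-inside : ∀ H U a → lookup (inside H U) a ≡ (lookup U (tail H a) ∧ lookup U (head H a))
lookup-inside H U = lookup∘tabulate (λ a → lookup U (tail H a) ∧ lookup U (head H a))

lookup-entering : ∀ H U a → lookup (entering H U) a ≡ (not (lookup U (tail H a)) ∧ lookup U (head H a))
lookup-entering H U = lookup∘tabulate (λ a → not (lookup U (tail H a)) ∧ lookup U (head H a))

enters⇒entering : ∀ H X a → Enters H X a → lookup (entering H X) a ≡ true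
enters⇒entering H X a (tail∉ , head∈) = trans (lookup-entering H X a) (∧-intro (cong not tail∉) head∈)

-- Let T connect U, with in-degrees at most
-- one and a root r ∈ U of in-degree zero.  Then T enters every nonempty
-- X ⊆ U avoiding r.  Otherwise the arcs of T with head outside X would be
-- fewer than |U ∖ X| (each head is a non-root node of U ∖ X), yet after
-- contracting X to a point they would still connect the |U ∖ X| + 1 nodes.
module _ (H : Digraph) (U : Subset (nV H)) (T : Subset (nA H)) (r : Fin (nV H))
  (within : ArcsWithin H U T) (conn : Connects H U T)
  (indeg≤1 : ∀ v → indeg H T v ≤ 1) (root : indeg H T r ≡ 0) (r∈U : lookup U r ≡ true)
  (X : Subset (nV H)) (X⊑U : X ⊑ U)
  (r∉X : lookup X r ≡ false) (x0 : Fin (nV H)) (x0∈X : lookup X x0 ≡ true) where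

  private
    T-out : Fin (nA H) → Bool
    T-out a = lookup T a ∧ not (lookup X (head H a))

    U-out : Fin (nV H) → Bool
    U-out v = lookup U v ∧ not (lookup X v)

    T-out-head : ∀ a → T-out a ≡ true → U-out (head H a) ≡ true
    T-out-head a h = ∧-intro (proj₂ (within a (proj₁ (∧-elim h)))) (proj₂ (∧-elim h))

    T-out⊆T : ∀ v a → (T-out a ∧ ⌊ head H a ≟ v ⌋) ≡ true → (lookup T a ∧ ⌊ head H a ≟ v ⌋) ≡ true
    T-out⊆T v a = ∧-forget (lookup T a) (not (lookup X (head H a))) ⌊ head H a ≟ v ⌋

    T-out-heads : ∀ v → count (λ a → T-out a ∧ ⌊ head H a ≟ v ⌋) ≤ χ (U-out v ∧ not ⌊ r ≟ v ⌋)
    T-out-heads v with U-out v ∧ not ⌊ r ≟ v ⌋ in bound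
    ... | true  = ≤-trans (count-mono (T-out⊆T v)) (subst (_≤ 1) (indeg≡count H T v) (indeg≤1 v))
    ... | false = ≤-reflexive (nothing-into v bound)
      where
      nothing-into : ∀ v → (U-out v ∧ not ⌊ r ≟ v ⌋) ≡ false → count (λ a → T-out a ∧ ⌊ head H a ≟ v ⌋) ≡ 0
      nothing-into v bound with r ≟ v
      ... | yes refl = n≤0⇒n≡0 (≤-trans (count-mono (T-out⊆T r)) (≤-reflexive (trans (sym (indeg≡count H T r)) root)))
      ... | no  _    = count-false _ λ a → ¬-not λ h → let T-out-a , head≡v = ∧-elim h in
        false≢true (trans (sym bound) (cong (_∧ true)
          (subst (λ w → U-out w ≡ true) (⌊⌋-sound (head H a ≟ v) head≡v) (T-out-head a T-out-a))))


    -- Hence fewer arcs than nodes outside X: |T-out| + 1 ≤ |U ∖ X| (the root is missed).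
    T-out-few : count T-out + 1 ≤ count U-out
    T-out-few = begin
      count T-out + 1
        ≡⟨ cong (_+ 1) (sym (count-by-colour (head H) T-out)) ⟩
      ∑[ v < nV H ] count (λ a → T-out a ∧ ⌊ head H a ≟ v ⌋) + 1
        ≤⟨ +-monoˡ-≤ 1 (∑-mono-≤ T-out-heads) ⟩
      count (λ v → U-out v ∧ not ⌊ r ≟ v ⌋) + 1
        ≡⟨ +-comm _ 1 ⟩
      1 + count (λ v → U-out v ∧ not ⌊ r ≟ v ⌋)
        ≡⟨ cong (_+ count (λ v → U-out v ∧ not ⌊ r ≟ v ⌋))
                (sym (trans (count-at U-out r) (cong χ (∧-intro r∈U (cong not r∉X))))) ⟩
      count (λ v → U-out v ∧ ⌊ r ≟ v ⌋) + count (λ v → U-out v ∧ not ⌊ r ≟ v ⌋)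
        ≡⟨ sym (count-split U-out (λ v → ⌊ r ≟ v ⌋)) ⟩
      count U-out ∎
      where open ≤-Reasoning

  entered : ∃ λ a → lookup T a ≡ true × Enters H X a
  entered with find-true (λ a → lookup T a ∧ (not (lookup X (tail H a)) ∧ lookup X (head H a)))
  ... | inj₁ (a , h) = let Ta , enter = ∧-elim {lookup T a} h
                           tail∉ , head∈ = ∧-elim {not (lookup X (tail H a))} enter
                       in a , Ta , not-true tail∉ , head∈
  ... | inj₂ none = ⊥-elim (1+n≰n (begin
      suc (count U-out)             ≡⟨ +-comm 1 _ ⟩
      count U-out + 1               ≡⟨ |U'| ⟩
      count (lookup C.U')           ≤⟨ connected-size C.H' C.U' T-out-set within' conn' ⟩
      count (lookup T-out-set) + 1     ≡⟨ cong (_+ 1) (sum-cong-≗ (λ a → cong χ (lookup∘tabulate T-out a))) ⟩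
      count T-out + 1               ≤⟨ T-out-few ⟩
      count U-out                   ∎))
    where
    open ≤-Reasoning
    module C = Contraction H U X x0
    T-out-set : Subset (nA H)
    T-out-set = tabulate T-out
    within' : ArcsWithin C.H' C.U' T-out-set
    within' = C.contract-within {T} {T-out-set} within
                (λ a h → proj₁ (∧-elim {lookup T a} (trans (sym (lookup∘tabulate T-out a)) h)))
    -- an arc of T with head in X has its tail in X too, so it becomes a loop
    conn' : Connects C.H' C.U' T-out-set
    conn' = C.contract-connects {T} {T-out-set} (X⊑U x0 x0∈X) kept conn
      where
      kept : ∀ a → lookup T a ≡ true → lookup T-out-set a ≡ true ⊎ C.f (tail H a) ≡ C.f (head H a)
      kept a Ta with lookup X (head H a) in head∈
      ... | false = inj₁ (trans (lookup∘tabulate T-out a) (cong₂ (λ b c → b ∧ not c) Ta head∈))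
      ... | true with lookup X (tail H a) in tail∈
      ...   | true  = inj₂ refl
      ...   | false = ⊥-elim (false≢true (trans (sym (none a)) (∧-intro Ta (∧-intro (cong not tail∈) head∈))))
    |U'| : count U-out + 1 ≡ count (lookup C.U')
    |U'| = sym (C.contracted-size-within X⊑U x0∈X)

heads-in : ∀ H (T : Subset (nA H)) → (∀ v → indeg H T v ≤ 1) → ∀ (U : Subset (nV H)) →
  count (λ a → lookup T a ∧ lookup U (head H a)) ≤ count (lookup U)
heads-in H T indeg≤1 U = begin
  count (λ a → lookup T a ∧ lookup U (head H a))
    ≡⟨ sym (count-by-colour (head H) _) ⟩
  ∑[ v < nV H ] count (λ a → (lookup T a ∧ lookup U (head H a)) ∧ ⌊ head H a ≟ v ⌋)
    ≤⟨ ∑-mono-≤ at-most-one ⟩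
  count (lookup U) ∎
  where
  open ≤-Reasoning
  at-most-one : ∀ v → count (λ a → (lookup T a ∧ lookup U (head H a)) ∧ ⌊ head H a ≟ v ⌋) ≤ χ (lookup U v)
  at-most-one v with lookup U v in Uv
  ... | true  = ≤-trans (count-mono (λ a → ∧-forget (lookup T a) _ _)) (subst (_≤ 1) (indeg≡count H T v) (indeg≤1 v))
  ... | false = ≤-reflexive (count-false _ λ a → ¬-not λ h →
    let T-and-U , head≡v = ∧-elim {lookup T a ∧ lookup U (head H a)} h in
    false≢true (trans (sym Uv) (subst (λ w → lookup U w ≡ true) (⌊⌋-sound (head H a ≟ v) head≡v)
                                      (proj₂ (∧-elim {lookup T a} T-and-U)))))

module _ {H : Digraph} {U : Subset (nV H)} {T : Subset (nA H)} (arb : SpanArb H U T) where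

  span-within : ArcsWithin H U T
  span-within a Ta = ∧-elim (trans (sym (lookup∘tabulate (λ a → lookup U (tail H a) ∧ lookup U (head H a)) a))
                                   (∈⇒lookup (proj₁ arb (lookup⇒∈ Ta))))

  span-connects : Connects H U T
  span-connects u v Uu Uv = proj₁ (proj₂ arb) u v (lookup⇒∈ Uu) (lookup⇒∈ Uv)

  span-size : count (lookup T) + 1 ≡ count (lookup U)
  span-size = subst₂ (λ x y → x + 1 ≡ y) (∣∣≡count T) (∣∣≡count U) (proj₁ (proj₂ (proj₂ arb)))

-- If the colour classes of F have in-degree
-- at most one and the arcs of F inside U form a k-arborescence of H[U], then
-- at most k arcs of F enter U: the k|U| available heads in U are taken by
-- the k(|U| - 1) arcs inside U and by the entering arcs.
entering≤k : ∀ k H (F : Subset (nA H)) (col : Fin (nA H) → Fin k) →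
  (∀ i v → indeg H (F ∩ colour col i) v ≤ 1) → ∀ U → KArb k H U (F ∩ inside H U) →
  count (λ a → lookup F a ∧ lookup (entering H U) a) ≤ k
entering≤k k H F col indeg≤1 U (col′ , arbs) =
  +-cancelˡ-≤ I _ k (begin
    I + E                    ≡⟨ +-comm I E ⟩
    E + I                    ≡⟨ entering+inside ⟩
    heads                    ≤⟨ heads≤ ⟩
    k * count (lookup U)     ≡⟨ sym inside+k ⟩
    I + k                    ∎)
  where
  open ≤-Reasoning
  E I heads : ℕ
  E = count (λ a → lookup F a ∧ lookup (entering H U) a)
  I = count (λ a → lookup F a ∧ lookup (inside H U) a)
  heads = count (λ a → lookup F a ∧ lookup U (head H a))

  entering+inside : E + I ≡ heads
  entering+inside = trans (sym (∑-distrib-+ (λ a → χ (lookup F a ∧ lookup (entering H U) a)) (λ a → χ (lookup F a ∧ lookup (inside H U) a))))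
    (sum-cong-≗ λ a → subst₂ (λ x y → χ (lookup F a ∧ x) + χ (lookup F a ∧ y) ≡ χ (lookup F a ∧ lookup U (head H a)))
      (sym (lookup-entering H U a)) (sym (lookup-inside H U a)) (split (lookup F a) (lookup U (tail H a)) (lookup U (head H a))))
    where
    split : ∀ f t h → χ (f ∧ (not t ∧ h)) + χ (f ∧ (t ∧ h)) ≡ χ (f ∧ h)
    split false t h = refl
    split true  true  h = refl
    split true  false true  = refl
    split true  false false = refl

  -- each colour class has in-degree at most one, so at most |U| heads in U
  heads≤ : heads ≤ k * count (lookup U)
  heads≤ = begin
    heads ≡⟨ sym (count-by-colour col _) ⟩
    ∑[ i < k ] count (λ a → (lookup F a ∧ lookup U (head H a)) ∧ ⌊ col a ≟ i ⌋)
      ≤⟨ ∑-mono-≤ (λ i → ≤-trans (≤-reflexive (sum-cong-≗ (λ a → cong χ (class i a))))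
                                  (heads-in H (F ∩ colour col i) (indeg≤1 i) U)) ⟩
    ∑[ i < k ] count (lookup U) ≡⟨ ∑-const k _ ⟩
    k * count (lookup U) ∎
    where
    class : ∀ i a → ((lookup F a ∧ lookup U (head H a)) ∧ ⌊ col a ≟ i ⌋)
                  ≡ (lookup (F ∩ colour col i) a ∧ lookup U (head H a))
    class i a rewrite lookup-colour F col i a with lookup F a
    ... | true  = ∧-comm (lookup U (head H a)) ⌊ col a ≟ i ⌋
    ... | false = refl

  -- the k arborescences of H[U] inside U have |U| - 1 arcs each
  inside+k : I + k ≡ k * count (lookup U)
  inside+k = begin-equality
    I + k                       ≡⟨ cong₂ _+_ (sym (count-by-colour col′ _)) (sym (trans (∑-const k 1) (*-identityʳ k))) ⟩
    ∑[ i < k ] count (λ a → (lookup F a ∧ lookup (inside H U) a) ∧ ⌊ col′ a ≟ i ⌋) + ∑[ i < k ] 1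
                                ≡⟨ sym (∑-distrib-+ (λ i → count (λ a → (lookup F a ∧ lookup (inside H U) a) ∧ ⌊ col′ a ≟ i ⌋)) (λ _ → 1)) ⟩
    ∑[ i < k ] (count (λ a → (lookup F a ∧ lookup (inside H U) a) ∧ ⌊ col′ a ≟ i ⌋) + 1)
                                ≡⟨ sum-cong-≗ class-size ⟩
    ∑[ i < k ] count (lookup U) ≡⟨ ∑-const k _ ⟩
    k * count (lookup U)        ∎
    where
    class-size : ∀ i → count (λ a → (lookup F a ∧ lookup (inside H U) a) ∧ ⌊ col′ a ≟ i ⌋) + 1 ≡ count (lookup U)
    class-size i = trans (cong (_+ 1) (sum-cong-≗ λ a → cong χ (sym (trans (lookup-colour (F ∩ inside H U) col′ i a)
                                                                     (cong (_∧ ⌊ col′ a ≟ i ⌋) (lookup-∩ F (inside H U) a))))))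
                         (span-size (arbs i))

module RootedColours {k} {H : Digraph} {U : Subset (nV H)} {r : Fin (nV H)} {F : Subset (nA H)}
  (r∈U : lookup U r ≡ true) (arb : RootedKArb k H U r F) where

  col : Fin (nA H) → Fin k
  col = proj₁ arb

  class : Fin k → Fin (nA H) → Bool
  class i a = lookup F a ∧ ⌊ col a ≟ i ⌋

  class⊆F : ∀ i a → class i a ≡ true → lookup F a ≡ true
  class⊆F i a h = proj₁ (∧-elim {lookup F a} h)

  class-indeg : ∀ i v → indeg H (F ∩ colour col i) v ≤ 1
  class-indeg i = proj₂ (proj₂ (proj₂ (proj₁ (proj₂ arb i))))

  colour-enters : ∀ i (X : Subset (nV H)) → X ⊑ U →
    lookup X r ≡ false → ∀ x → lookup X x ≡ true → ∃ λ a → class i a ≡ true × Enters H X a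
  colour-enters i X X⊑U r∉X x x∈X =
    let a , a∈Ti , enters = entered H U Ti r (span-within arbᵢ) (span-connects arbᵢ) (class-indeg i)
                              (proj₂ (proj₂ arb i)) r∈U X X⊑U r∉X x x∈X
    in a , trans (sym (lookup-colour F col i a)) a∈Ti , enters
    where
    Ti = F ∩ colour col i
    arbᵢ = proj₁ (proj₂ arb i)

  enters-once : ∀ (X : Subset (nV H)) → KArb k H X (F ∩ inside H X) →
    X ⊑ U → lookup X r ≡ false → ∀ x → lookup X x ≡ true →
    ∀ i a b → class i a ≡ true → class i b ≡ true → Enters H X a → Enters H X b → a ≡ b
  enters-once X tight X⊑U r∉X x x∈X i a b ia ib a-enters b-enters =
    count≤1-unique (λ a → class i a ∧ enter a) (each≤1 per-colour total≥ at-least-one i) a b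
      (∧-intro ia (enters⇒entering H X a a-enters)) (∧-intro ib (enters⇒entering H X b b-enters))
    where
    enter : Fin (nA H) → Bool
    enter = lookup (entering H X)
    per-colour : Fin k → ℕ
    per-colour j = count (λ a → class j a ∧ enter a)
    total≥ : sum per-colour ≤ k
    total≥ = ≤-trans (≤-reflexive (trans (sum-cong-≗ λ j → sum-cong-≗ λ a → cong χ (regroup j a))
                                         (count-by-colour col (λ a → lookup F a ∧ enter a))))
                     (entering≤k k H F col class-indeg X tight)
      where
      regroup : ∀ j a → (class j a ∧ enter a) ≡ ((lookup F a ∧ enter a) ∧ ⌊ col a ≟ j ⌋)
      regroup j a = trans (∧-assoc (lookup F a) _ _) (trans (cong (lookup F a ∧_) (∧-comm ⌊ col a ≟ j ⌋ (enter a)))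
                                                              (sym (∧-assoc (lookup F a) _ _)))
    at-least-one : ∀ j → 1 ≤ per-colour j
    at-least-one j = let a , ja , a-enters = colour-enters j X X⊑U r∉X x x∈X in
      ≤-trans (≤-reflexive (cong χ (sym (∧-intro ja (enters⇒entering H X a a-enters))))) (term≤∑ (λ a → χ (class j a ∧ enter a)) a)

lift-sound : ∀ {n} (X : Subset n) x → lookup (lift X) x ≡ true → ∃ λ v → x ≡ suc v × lookup X v ≡ true
lift-sound X (suc v) Xv = v , refl , Xv

lift-⊑ : ∀ {n} {X Y : Subset n} → X ⊑ Y → lift X ⊑ lift Y
lift-⊑ X⊑Y (suc v) = X⊑Y v

lift-contr : ∀ {n} (W X : Subset n) → X ⊑ W → ∀ x → lookup (lift X) (contr W x) ≡ lookup (lift X) x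
lift-contr W X X⊑W zero    = refl
lift-contr W X X⊑W (suc v) with lookup W v in Wv
... | true  = refl
... | false with lookup X v in Xv
...   | false = refl
...   | true  with () ← trans (sym Wv) (X⊑W v Xv)

entering-DW : ∀ k D W X → X ⊑ W → ∀ a →
  lookup (entering (DW k D W) (lift X)) a ≡ lookup (entering (plus k D) (lift X)) a
entering-DW k D W X X⊑W a = begin
  lookup (entering (DW k D W) (lift X)) a
    ≡⟨ lookup-entering (DW k D W) (lift X) a ⟩
  not (lookup (lift X) (contr W (tail P a))) ∧ lookup (lift X) (contr W (head P a))
    ≡⟨ cong₂ (λ t h → not t ∧ h) (lift-contr W X X⊑W (tail P a)) (lift-contr W X X⊑W (head P a)) ⟩
  not (lookup (lift X) (tail P a)) ∧ lookup (lift X) (head P a)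
    ≡⟨ sym (lookup-entering P (lift X) a) ⟩
  lookup (entering P (lift X)) a ∎
  where
  open ≡-Reasoning
  P = plus k D

plus-old-arc : ∀ k D a d → splitAt (nA D) a ≡ inj₁ d →
  tail (plus k D) a ≡ suc (tail D d) × head (plus k D) a ≡ suc (head D d)
plus-old-arc k D a d split with splitAt (nA D) a | split
... | inj₁ .d | refl = refl , refl

plus-new-arc : ∀ k D a j → splitAt (nA D) a ≡ inj₂ j → tail (plus k D) a ≡ zero
plus-new-arc k D a j split with splitAt (nA D) a | split
... | inj₂ .j | refl = refl

module Descent {k} (D : Digraph) (L : List (Subset (nV D))) (lam : Laminar L)
  (W Z : Subset (nV D)) (Z⊑W : Z ⊑ W)
  (F : Subset (nA (plus k D))) (arb : RootedKArb k (DW k D W) (nodesW W) zero F)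
  (tight : Tight k (DW k D W) (LW L W) F) where

  H : Digraph
  H = DW k D W

  open RootedColours {k} {H} {nodesW W} {zero} {F} refl arb public

  lift⊑nodesW : ∀ {X} → X ⊑ W → lift X ⊑ nodesW W
  lift⊑nodesW X⊑W (suc v) = X⊑W v

  colour-enters-member : ∀ i {P} → P ⊑ W → ∀ x → lookup P x ≡ true → ∃ λ a → class i a ≡ true × Enters H (lift P) a
  colour-enters-member i {P} P⊑W x Px = colour-enters i (lift P) (lift⊑nodesW P⊑W) refl (suc x) Px

  enters-member-once : ∀ {P} → P ∈L L → P ⊑ W → ∀ x → lookup P x ≡ true → ∀ i a b →
    class i a ≡ true → class i b ≡ true → Enters H (lift P) a → Enters H (lift P) b → a ≡ b
  enters-member-once {P} P∈L P⊑W x Px =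
    enters-once (lift P) (tight (lift P) (P , P∈L , ⊑⇒⊆ P⊑W , refl)) (lift⊑nodesW P⊑W) refl (suc x) Px

  NoLeaving : Subset (nV D) → Fin (nA H) → Set
  NoLeaving P g = ∀ W' → W' ∈L L → W' ⊑ P → Meets W' Z →
    lookup (lift W') (tail H g) ≡ true → lookup (lift W') (head H g) ≡ true

  Inside : Subset (nV D) → Fin (nA H) → Set
  Inside P g = lookup (lift P) (tail H g) ≡ true × lookup (lift P) (head H g) ≡ true

  Found : Fin k → Subset (nV D) → Fin (nA H) → Set
  Found i P e = ∃ λ g → class i g ≡ true × Enters H (lift Z) g × NoLeaving P g × (g ≡ e ⊎ Inside P g)

  DescentFrom : Fin k → Subset (nV D) → Set
  DescentFrom i P = P ∈L L → P ⊑ W → ∀ x → lookup P x ≡ true → lookup Z x ≡ true →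
    ∀ e → class i e ≡ true → Enters H (lift P) e → lookup (lift Z) (tail H e) ≡ false → Found i P e

  Splits : Subset (nV D) → Subset (nV D) → Bool
  Splits P W'' = subsetᵇ W'' P ∧ meetsᵇ W'' Z ∧ not (subsetᵇ (P ∩ Z) W'')

  splits-intro : ∀ P W'' → W'' ⊑ P → Meets W'' Z → ∀ v → lookup P v ≡ true → lookup Z v ≡ true →
    lookup W'' v ≡ false → Splits P W'' ≡ true
  splits-intro P W'' W''⊑P meets v Pv Zv W''v =
    ∧-intro (subsetᵇ-complete W'' P W''⊑P)
      (∧-intro (meetsᵇ-complete W'' Z meets)
        (cong not (subsetᵇ-refute (P ∩ Z) W'' v (trans (lookup-∩ P Z v) (∧-intro Pv Zv)) W''v)))

  splits-elim : ∀ P W'' → Splits P W'' ≡ true →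
    W'' ⊑ P × Meets W'' Z × ∃ λ v → lookup P v ≡ true × lookup W'' v ≡ false
  splits-elim P W'' h =
    let sub , rest = ∧-elim {subsetᵇ W'' P} h
        meets , not-sub = ∧-elim {meetsᵇ W'' Z} rest
        v , PZv , W''v = subsetᵇ-false (P ∩ Z) W'' (not-true not-sub)
    in subsetᵇ-sound W'' P sub , meetsᵇ-sound W'' Z meets ,
       v , proj₁ (∧-elim {lookup P v} (trans (sym (lookup-∩ P Z v)) PZv)) , W''v

  core : Subset (nV D) → Subset (nV D)
  core P = tabulate (λ v → (lookup P v ∧ lookup Z v) ∨ any (λ W'' → Splits P W'' ∧ lookup W'' v) L)

  lookup-core : ∀ P v → lookup (core P) v ≡ ((lookup P v ∧ lookup Z v) ∨ any (λ W'' → Splits P W'' ∧ lookup W'' v) L)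
  lookup-core P = lookup∘tabulate (λ v → (lookup P v ∧ lookup Z v) ∨ any (λ W'' → Splits P W'' ∧ lookup W'' v) L)

  core-cases : ∀ P v → lookup (core P) v ≡ true →
    (lookup P v ≡ true × lookup Z v ≡ true) ⊎ ∃ λ W'' → W'' ∈L L × Splits P W'' ≡ true × lookup W'' v ≡ true
  core-cases P v h with lookup P v ∧ lookup Z v in PZv
  ... | true  = inj₁ (∧-elim PZv)
  ... | false = let W'' , W''∈L , s = any-sound (λ W'' → Splits P W'' ∧ lookup W'' v) L
                                        (trans (sym (trans (lookup-core P v) (cong (_∨ any (λ W'' → Splits P W'' ∧ lookup W'' v) L) PZv))) h)
                in inj₂ (W'' , W''∈L , ∧-elim {Splits P W''} s)

  core⊑P : ∀ P → core P ⊑ P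
  core⊑P P v h with core-cases P v h
  ... | inj₁ (Pv , _) = Pv
  ... | inj₂ (W'' , _ , s , W''v) = proj₁ (splits-elim P W'' s) v W''v

  P∩Z⊑core : ∀ P v → lookup P v ≡ true → lookup Z v ≡ true → lookup (core P) v ≡ true
  P∩Z⊑core P v Pv Zv = trans (lookup-core P v) (cong (_∨ any (λ W'' → Splits P W'' ∧ lookup W'' v) L) (∧-intro Pv Zv))

  splitter⊑core : ∀ P W'' → W'' ∈L L → Splits P W'' ≡ true → W'' ⊑ core P
  splitter⊑core P W'' W''∈L s v W''v = trans (lookup-core P v)
    (trans (cong ((lookup P v ∧ lookup Z v) ∨_) (any-complete (λ W'' → Splits P W'' ∧ lookup W'' v) L W'' W''∈L (∧-intro s W''v)))
           (∨-zeroʳ _))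

  module Step (i : Fin k) (P : Subset (nV D)) (P∈L : P ∈L L) (P⊑W : P ⊑ W)
    (x : Fin (nV D)) (Px : lookup P x ≡ true) (Zx : lookup Z x ≡ true)
    (e : Fin (nA H)) (ie : class i e ≡ true) (e-enters : Enters H (lift P) e)
    (e-tail∉Z : lookup (lift Z) (tail H e) ≡ false) where

    g-enters-core : ∃ λ g → class i g ≡ true × Enters H (lift (core P)) g
    g-enters-core = colour-enters-member i (λ u h → P⊑W u (core⊑P P u h)) x (P∩Z⊑core P x Px Zx)

    g : Fin (nA H)
    g = proj₁ g-enters-core

    ig : class i g ≡ true
    ig = proj₁ (proj₂ g-enters-core)

    g-tail∉core : lookup (lift (core P)) (tail H g) ≡ false
    g-tail∉core = proj₁ (proj₂ (proj₂ g-enters-core))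

    v-data : ∃ λ v → head H g ≡ suc v × lookup (core P) v ≡ true
    v-data = lift-sound (core P) (head H g) (proj₂ (proj₂ (proj₂ g-enters-core)))

    v : Fin (nV D)
    v = proj₁ v-data

    head≡v : head H g ≡ suc v
    head≡v = proj₁ (proj₂ v-data)

    v∈core : lookup (core P) v ≡ true
    v∈core = proj₂ (proj₂ v-data)

    Pv : lookup P v ≡ true
    Pv = core⊑P P v v∈core

    tail∉splitter : ∀ W'' → W'' ∈L L → Splits P W'' ≡ true → lookup (lift W'') (tail H g) ≡ false
    tail∉splitter W'' W''∈L s with lookup (lift W'') (tail H g) in tail∈
    ... | false = refl
    ... | true  = ⊥-elim (false≢true (trans (sym g-tail∉core) (lift-⊑ (splitter⊑core P W'' W''∈L s) (tail H g) tail∈)))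

    tail-facts : lookup (lift Z) (tail H g) ≡ false × (g ≡ e ⊎ Inside P g)
    tail-facts with lookup (lift P) (tail H g) in tail∈P
    ... | false = subst (λ a → lookup (lift Z) (tail H a) ≡ false) (sym g≡e) e-tail∉Z , inj₁ g≡e
      where
      g≡e : g ≡ e
      g≡e = enters-member-once P∈L P⊑W x Px i g e ig ie (tail∈P , head∈P) e-enters
        where head∈P = trans (cong (lookup (lift P)) head≡v) Pv
    ... | true  = tail∉Z , inj₂ (refl , trans (cong (lookup (lift P)) head≡v) Pv)
      where
      tail∉Z : lookup (lift Z) (tail H g) ≡ false
      tail∉Z with lift-sound P (tail H g) tail∈P
      ... | u , tail≡u , Pu with lookup Z u in Zu
      ...   | false = trans (cong (lookup (lift Z)) tail≡u) Zu
      ...   | true  = ⊥-elim (false≢true (trans (sym g-tail∉core) (trans (cong (lookup (lift (core P))) tail≡u) (P∩Z⊑core P u Pu Zu))))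

    -- If v ∈ Z, then g itself will do: a member W' ⊆ P meeting Z that contains
    -- the tail but not the head of g would split P, hence lie in the core.
    found-in-Z : lookup Z v ≡ true → Found i P e
    found-in-Z Zv = g , ig , (proj₁ tail-facts , trans (cong (lookup (lift Z)) head≡v) Zv) , no-leaving , proj₂ tail-facts
      where
      no-leaving : NoLeaving P g
      no-leaving W' W'∈L W'⊑P meets tail∈W' with lookup W' v in W'v
      ... | true  = trans (cong (lookup (lift W')) head≡v) W'v
      ... | false = ⊥-elim (false≢true (trans (sym (tail∉splitter W' W'∈L (splits-intro P W' W'⊑P meets v Pv Zv W'v))) tail∈W'))

    -- Otherwise v lies in a member W'' splitting P, which g enters; W'' is a
    -- proper subset of P, and the descent into W'' yields an arc inside W''
    -- (it cannot be g, whose head is outside Z), which by laminarity leaves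
    -- no member of L[P] meeting Z either.
    found-below : lookup Z v ≡ false → (∀ Q → count (lookup Q) < count (lookup P) → DescentFrom i Q) → Found i P e
    found-below Zv descend-into with core-cases P v v∈core
    ... | inj₁ (_ , Zv′) = ⊥-elim (false≢true (trans (sym Zv) Zv′))
    ... | inj₂ (W'' , W''∈L , s , W''v) with splits-elim P W'' s
    ...   | W''⊑P , (y , W''y , Zy) , (u , Pu , W''u) with
              descend-into W'' (count-< W''⊑P u Pu W''u) W''∈L (λ w h → P⊑W w (W''⊑P w h)) y W''y Zy
                g ig (tail∉splitter W'' W''∈L s , trans (cong (lookup (lift W'')) head≡v) W''v) (proj₁ tail-facts)
    ...     | g′ , ig′ , g′-enters-Z , no-leaving″ , inj₁ refl =
                ⊥-elim (false≢true (trans (sym Zv) (trans (sym (cong (lookup (lift Z)) head≡v)) (proj₂ g′-enters-Z))))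
    ...     | g′ , ig′ , g′-enters-Z , no-leaving″ , inj₂ (tail∈W'' , head∈W'') =
                g′ , ig′ , g′-enters-Z , no-leaving , inj₂ (lift-⊑ W''⊑P (tail H g′) tail∈W'' , lift-⊑ W''⊑P (head H g′) head∈W'')
      where
      no-leaving : NoLeaving P g′
      no-leaving W' W'∈L W'⊑P meets tail∈W' with lam W' W'' W'∈L W''∈L
      ... | inj₁ W'⊆W''        = no-leaving″ W' W'∈L (⊆⇒⊑ W'⊆W'') meets tail∈W'
      ... | inj₂ (inj₁ W''⊆W') = lift-⊑ (⊆⇒⊑ W''⊆W') (head H g′) head∈W''
      ... | inj₂ (inj₂ disjoint) with lift-sound W' (tail H g′) tail∈W'
      ...   | w , tail≡w , W'w = ⊥-elim (disjoint w (lookup⇒∈ W'w) (lookup⇒∈ (trans (cong (lookup (lift W'')) (sym tail≡w)) tail∈W'')))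

    found : (∀ Q → count (lookup Q) < count (lookup P) → DescentFrom i Q) → Found i P e
    found descend-into with lookup Z v in Zv
    ... | true  = found-in-Z Zv
    ... | false = found-below Zv descend-into

  descend : ∀ i n P → count (lookup P) < n → DescentFrom i P
  descend i (suc n) P |P|<n P∈L P⊑W x Px Zx e ie e-enters e-tail∉Z =
    Step.found i P P∈L P⊑W x Px Zx e ie e-enters e-tail∉Z
      (λ Q |Q|<|P| → descend i n Q (≤-trans |Q|<|P| (s≤s⁻¹ |P|<n)))

fW-arc : (D : Digraph) → List (Subset (nV D)) → Subset (nV D) → Subset (nV D) → Fin (nA D) → Bool
fW-arc D L W Z e = lookup (inside D W) e ∧ lookup (entering D Z) e
  ∧ not (any (λ W' → subsetᵇ W' W ∧ meetsᵇ W' Z ∧ leavesᵇ D W' e) L)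

fW≡count : ∀ D L W Z → fW D L W Z ≡ count (fW-arc D L W Z)
fW≡count D L W Z = trans (∣∣≡count (tabulate (fW-arc D L W Z))) (sum-cong-≗ (λ e → cong χ (lookup∘tabulate (fW-arc D L W Z) e)))

old-arc : ∀ {m n} → (Fin m → Bool) → Fin m ⊎ Fin n → Bool
old-arc p (inj₁ d) = p d
old-arc p (inj₂ _) = false

count-old-arc : ∀ m {n} (p : Fin m → Bool) → count (λ a → old-arc {m} {n} p (splitAt m a)) ≡ count p
count-old-arc m {n} p = trans (∑-splitAt m (λ s → χ (old-arc p s))) (trans (cong (count p +_) (sum-replicate-zero n)) (+-identityʳ _))

ϱ≡count : ∀ k D E Z → ϱ k D E Z ≡ count (λ a → lookup E a ∧ lookup (entering (plus k D) (lift Z)) a)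
ϱ≡count k D E Z = trans (∣∣≡count (E ∩ entering (plus k D) (lift Z))) (sum-cong-≗ (λ a → cong χ (lookup-∩ E (entering (plus k D) (lift Z)) a)))

old-arc-ends : ∀ k D W X → X ⊑ W → ∀ a d → splitAt (nA D) a ≡ inj₁ d →
  lookup (lift X) (tail (DW k D W) a) ≡ lookup X (tail D d) × lookup (lift X) (head (DW k D W) a) ≡ lookup X (head D d)
old-arc-ends k D W X X⊑W a d split =
  trans (lift-contr W X X⊑W (tail (plus k D) a)) (cong (lookup (lift X)) (proj₁ (plus-old-arc k D a d split))) ,
  trans (lift-contr W X X⊑W (head (plus k D) a)) (cong (lookup (lift X)) (proj₂ (plus-old-arc k D a d split)))

module ColourWitnesses {k} (D : Digraph) (L : List (Subset (nV D))) (lam : Laminar L)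
  (W : Subset (nV D)) (W∈L : W ∈L L) (Z : Subset (nV D)) (Z⊑W : Z ⊑ W)
  (z0 : Fin (nV D)) (Zz0 : lookup Z z0 ≡ true)
  (F : Subset (nA (plus k D))) (arb : RootedKArb k (DW k D W) (nodesW W) zero F)
  (tight : Tight k (DW k D W) (LW L W) F)
  (B : Subset (nA (plus k D))) (B⊆δ : B ⊆ δinPlus k D W) (|B| : ∣ B ∣ ≡ k) (B⊆F : B ⊆ F) where

  open Descent D L lam W Z Z⊑W F arb tight

  entZ : Fin (nA (plus k D)) → Bool
  entZ = lookup (entering (plus k D) (lift Z))

  fW-arc⁺ : Fin (nA (plus k D)) → Bool
  fW-arc⁺ a = old-arc (fW-arc D L W Z) (splitAt (nA D) a)

  -- B contains every arc of F entering W: it has k of them, and F has at most k.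
  B-full : ∀ a → lookup F a ≡ true → Enters H (lift W) a → lookup B a ≡ true
  B-full a Fa a-enters with lookup B a in Ba
  ... | true  = refl
  ... | false = ⊥-elim (1+n≰n (begin
      suc k                                              ≡⟨ cong suc (trans (sym |B|) (∣∣≡count B)) ⟩
      suc (count (lookup B))                             ≤⟨ count-< B⇒F∩entering a (∧-intro Fa (enters⇒entering H (lift W) a a-enters)) Ba ⟩
      count (λ b → lookup F b ∧ lookup (entering H (lift W)) b)
                                                         ≤⟨ entering≤k k H F col class-indeg (lift W) (tight (lift W) (W , W∈L , ⊆-refl , refl)) ⟩
      k                                                  ∎))
    where
    open ≤-Reasoning
    B⇒F∩entering : ∀ b → lookup B b ≡ true → (lookup F b ∧ lookup (entering H (lift W)) b) ≡ true
    B⇒F∩entering b Bb = ∧-intro (∈⇒lookup (B⊆F (lookup⇒∈ Bb)))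
      (trans (entering-DW k D W W (⊑-refl W) b) (∈⇒lookup (B⊆δ (lookup⇒∈ Bb))))

  counted-by-fW : ∀ g → Enters H (lift Z) g → NoLeaving W g → Inside W g → fW-arc⁺ g ≡ true
  counted-by-fW g (tail∉Z , head∈Z) no-leaving (tail∈W , head∈W) = old (splitAt (nA D) g) refl
    where
    old : ∀ s → splitAt (nA D) g ≡ s → old-arc (fW-arc D L W Z) s ≡ true
    old (inj₂ j) split = ⊥-elim (false≢true (trans (cong (λ x → lookup (lift W) (contr W x)) (sym (plus-new-arc k D g j split))) tail∈W))
    old (inj₁ d) split = ∧-intro (trans (lookup-inside D W d) (∧-intro (in-D-tail W (⊑-refl W) tail∈W) (in-D-head W (⊑-refl W) head∈W)))
                           (∧-intro (trans (lookup-entering D Z d) (∧-intro (cong not (in-D-tail Z Z⊑W tail∉Z)) (in-D-head Z Z⊑W head∈Z)))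
                                    (cong not (any-false _ L leaves-none)))
      where
      in-D-tail : ∀ X → X ⊑ W → ∀ {b} → lookup (lift X) (tail H g) ≡ b → lookup X (tail D d) ≡ b
      in-D-tail X X⊑W h = trans (sym (proj₁ (old-arc-ends k D W X X⊑W g d split))) h
      in-D-head : ∀ X → X ⊑ W → ∀ {b} → lookup (lift X) (head H g) ≡ b → lookup X (head D d) ≡ b
      in-D-head X X⊑W h = trans (sym (proj₂ (old-arc-ends k D W X X⊑W g d split))) h
      leaves-none : ∀ W' → W' List.∈ L → (subsetᵇ W' W ∧ meetsᵇ W' Z ∧ leavesᵇ D W' d) ≡ false
      leaves-none W' W'∈L with subsetᵇ W' W in sub | meetsᵇ W' Z in meets
      ... | false | _     = refl
      ... | true  | false = refl
      ... | true  | true with lookup W' (tail D d) in tail∈W'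
      ...   | false = refl
      ...   | true  = cong not (in-D-head W' W'⊑W (no-leaving W' W'∈L W'⊑W (meetsᵇ-sound W' Z meets)
                                                 (trans (proj₁ (old-arc-ends k D W W' W'⊑W g d split)) tail∈W')))
        where
        W'⊑W : W' ⊑ W
        W'⊑W = subsetᵇ-sound W' W sub

  witness : ∀ j → ∃ λ g → col g ≡ j × ((lookup B g ∧ entZ g) ∨ fW-arc⁺ g) ≡ true
  witness j with colour-enters-member j (⊑-refl W) z0 (Z⊑W z0 Zz0)
  ... | e , je , e-enters-W with descend j (suc (count (lookup W))) W ≤-refl W∈L (⊑-refl W) z0 (Z⊑W z0 Zz0) Zz0
                                   e je e-enters-W e-tail∉Z
    where
    e-tail∉Z : lookup (lift Z) (tail H e) ≡ false
    e-tail∉Z with lookup (lift Z) (tail H e) in tail∈Z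
    ... | false = refl
    ... | true  = ⊥-elim (false≢true (trans (sym (proj₁ e-enters-W)) (lift-⊑ Z⊑W (tail H e) tail∈Z)))
  ... | g , jg , g-enters-Z , no-leaving , g≡e⊎inside = g , ⌊⌋-sound (col g ≟ j) (proj₂ (∧-elim {lookup F g} jg)) , in-S g≡e⊎inside
    where
    in-S : g ≡ e ⊎ Inside W g → ((lookup B g ∧ entZ g) ∨ fW-arc⁺ g) ≡ true
    in-S (inj₁ refl) = cong (_∨ fW-arc⁺ g) (∧-intro (B-full g (class⊆F j g jg) e-enters-W)
                         (trans (sym (entering-DW k D W Z Z⊑W g)) (enters⇒entering H (lift Z) g g-enters-Z)))
    in-S (inj₂ inside) = trans (cong ((lookup B g ∧ entZ g) ∨_) (counted-by-fW g g-enters-Z no-leaving inside)) (∨-zeroʳ _)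

  k≤ : k ≤ count (λ a → lookup B a ∧ entZ a) + count (fW-arc D L W Z)
  k≤ = begin
    k                                                        ≤⟨ colours-hit col _ witness ⟩
    count (λ a → (lookup B a ∧ entZ a) ∨ fW-arc⁺ a)          ≤⟨ count-∨ (λ a → lookup B a ∧ entZ a) fW-arc⁺ ⟩
    count (λ a → lookup B a ∧ entZ a) + count fW-arc⁺        ≡⟨ cong (count (λ a → lookup B a ∧ entZ a) +_) (count-old-arc (nA D) (fW-arc D L W Z)) ⟩
    count (λ a → lookup B a ∧ entZ a) + count (fW-arc D L W Z) ∎
    where open ≤-Reasoning

  B-outside≤fW : count (λ a → lookup B a ∧ not (entZ a)) ≤ count (fW-arc D L W Z)
  B-outside≤fW = +-cancelˡ-≤ (count (λ a → lookup B a ∧ entZ a)) _ _ (begin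
    count (λ a → lookup B a ∧ entZ a) + count (λ a → lookup B a ∧ not (entZ a))
      ≡⟨ sym (count-split (lookup B) entZ) ⟩
    count (lookup B)  ≡⟨ sym (∣∣≡count B) ⟩
    ∣ B ∣             ≡⟨ |B| ⟩
    k                 ≤⟨ k≤ ⟩
    count (λ a → lookup B a ∧ entZ a) + count (fW-arc D L W Z) ∎)
    where open ≤-Reasoning

split-independent : ∀ {m} (I E B : Subset m) (ent : Fin m → Bool) → I ⊑ E → I ⊑ B →
  count (lookup I) ≤ count (λ a → lookup E a ∧ ent a) + count (λ a → lookup B a ∧ not (ent a))
split-independent I E B ent I⊑E I⊑B =
  ≤-trans (count-mono covered) (count-∨ (λ a → lookup E a ∧ ent a) (λ a → lookup B a ∧ not (ent a)))
  where
  covered : ∀ a → lookup I a ≡ true → ((lookup E a ∧ ent a) ∨ (lookup B a ∧ not (ent a))) ≡ true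
  covered a Ia with ent a
  ... | true  = cong (_∨ _) (∧-intro (I⊑E a Ia) refl)
  ... | false = trans (cong (λ b → (b ∧ false) ∨ (lookup B a ∧ true)) (I⊑E a Ia)) (∧-intro (I⊑B a Ia) refl)

lemma5p6 : (k : ℕ) → 0 < k → (D : Digraph) → (L : List (Subset (nV D)))
    → Laminar L → ⊤ ∈L L → (∀ (v : Fin (nV D)) → ⁅ v ⁆ ∈L L)
    → HasTightKArb k D L
    → (W : Subset (nV D)) → W ∈L L
    → (E : Subset (nA (plus k D))) → E ⊆ δinPlus k D W
    → (Z : Subset (nV D)) → Nonempty Z → Z ⊆ W
    → RankW≤ k D L W E (fW D L W Z + ϱ k D E Z)
lemma5p6 k _ D L lam _ _ _ W W∈L E _ Z (z0 , z0∈Z) Z⊆W I I⊆E (B , (B⊆δ , |B| , F , B⊆F , arb , tight) , I⊆B) = begin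
  ∣ I ∣                                                  ≡⟨ ∣∣≡count I ⟩
  count (lookup I)                                       ≤⟨ split-independent I E B C.entZ (⊆⇒⊑ I⊆E) (⊆⇒⊑ I⊆B) ⟩
  count (λ a → lookup E a ∧ C.entZ a) + count (λ a → lookup B a ∧ not (C.entZ a))
                                                         ≤⟨ +-monoʳ-≤ _ C.B-outside≤fW ⟩
  count (λ a → lookup E a ∧ C.entZ a) + count (fW-arc D L W Z)
                                                         ≡⟨ cong₂ _+_ (sym (ϱ≡count k D E Z)) (sym (fW≡count D L W Z)) ⟩
  ϱ k D E Z + fW D L W Z                                 ≡⟨ +-comm (ϱ k D E Z) _ ⟩
  fW D L W Z + ϱ k D E Z                                 ∎
  where
  open ≤-Reasoning
  module C = ColourWitnesses D L lam W W∈L Z (⊆⇒⊑ Z⊆W) z0 (∈⇒lookup z0∈Z) F arb tight B B⊆δ |B| B⊆F
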